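{- Let $m,n$ be non-negative integers. Then \[ \sum_{k=0}^n(-1)^{n-k}k^m\binom nk\binom{k+n}{k}=\sum_{k=0}^m k!\binom nk\binom{k+n}{k}\left\{{m\atop k}\right\} \] and \[ \sum_{k=0}^n(-1)^k k^m\binom nk\binom{2n-k}{n-k}=\sum_{k=0}^m(-1)^k k!\binom nk\binom{k+n}{k}\left\{{m+n-k\atop n}\right\}_{n-k}. \]
   Context: Binomial coefficients are the usual ones, with $\binom nk=0$ for $k>n$. $\left\{{m\atop k}\right\}=\frac1{k!}\sum_{p=0}^k(-1)^{k-p}\binom kp p^m$ (with $0^0=1$) is the Stirling number of the second kind. For non-negative integers $u,m$ and an integer $v$, $\left\{{m+v\atop u+v}\right\}_v=\frac1{u!}\sum_{p=0}^u(-1)^{u-p}\binom up(v+p)^m$ is the $v$-Stirling number of the second kind; thus $\left\{{m+n-k\atop n}\right\}_{n-k}=\frac1{k!}\sum_{p=0}^k(-1)^{k-p}\binom kp(n-k+p)^m$. -}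

module Defs where

open import Data.Nat as ℕ using (ℕ; zero; suc)
open import Data.Nat.Combinatorics using (_C_)
open import Data.Nat.Base using (_!)
open import Data.Nat.Properties using (_!≢0)
open import Data.Integer as ℤ using (ℤ; +_)
open import Data.Integer.DivMod using (_/ℕ_)

sumTo : ℕ → (ℕ → ℤ) → ℤ
sumTo zero    f = f zero
sumTo (suc n) f = sumTo n f ℤ.+ f (suc n)

sign : ℕ → ℤ
sign zero          = + 1
sign (suc zero)    = ℤ.- (+ 1)
sign (suc (suc j)) = sign j

-- binomial coefficient as an integer (0 when k > n, per stdlib _C_)
binom : ℕ → ℕ → ℤ
binom n k = + (n C k)

-- Stirling number of the second kind, exactly as in the paper:
-- {m over k} = (1/k!) Σ_{p=0}^k (-1)^{k-p} C(k,p) p^m   (0^0 = 1 in ℕ._^_)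
stirling2 : ℕ → ℕ → ℤ
stirling2 m k =
  sumTo k (λ p → sign (k ℕ.∸ p) ℤ.* binom k p ℤ.* + (p ℕ.^ m)) /ℕ (k !)
  where instance _ = k !≢0

-- v-Stirling number {m+n-k over n}_{n-k}
--   = (1/k!) Σ_{p=0}^k (-1)^{k-p} C(k,p) (n-k+p)^m      (for k ≤ n)
vStirling : ℕ → ℕ → ℕ → ℤ
vStirling m n k =
  sumTo k (λ p → sign (k ℕ.∸ p) ℤ.* binom k p ℤ.* + ((n ℕ.∸ k ℕ.+ p) ℕ.^ m)) /ℕ (k !)
  where instance _ = k !≢0

{-# OPTIONS --safe #-}
-- Write Δ k g = Σ_p (-1)^(k-p) C(k,p) g(p) for the k-th forward difference of g at 0. By the
-- Leibniz rule for Δ, Δ k ((v + _)^m) satisfies k! times the triangular recurrence of the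
-- v-Stirling numbers, so it equals k!·{m+v over k+v}_v and vanishes for k > m. The right-hand side
-- of each identity is therefore Σ_k C(n,k) C(k+n,k) Δ k g, with g(p) = p^m, resp. g(p) = (n-p)^m
-- (reflecting p ↦ k - p turns (-1)^k Δ k ((n-k+_)^m) into Δ k ((n-_)^m)). Exchanging the sums
-- gives Σ_p (-1)^(n-p) C(n,p) C(p+n,p) g(p), the left-hand side (after p ↦ n - p in the second
-- case), because the subset identity C(n,k) C(k,p) = C(n,p) C(n-p,k-p) and Δ R C(c+_, K+R) = C(c,K)
-- evaluate Σ_k (-1)^(k-p) C(n,k) C(k,p) C(k+n,k) to (-1)^(n-p) C(n,p) C(p+n,p).
module Submission where

open import Defs
open import Data.Nat as ℕ using (ℕ; zero; suc; z≤n; s≤s; _≤′_; ≤′-refl; ≤′-step; _!)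
import Data.Nat.Properties as ℕ
open import Data.Nat.Properties using (_!≢0)
open import Data.Nat.DivMod using (m/n*n≡m; m*n/n≡m)
open import Data.Nat.Combinatorics
  using (_C_; nCk+nC[k+1]≡[n+1]C[k+1]; k>n⇒nCk≡0; nCk≡nC[n∸k]; nC1≡n; nCk≡n!/k![n-k]!; k![n∸k]!∣n!)
import Data.Nat.Tactic.RingSolver as ℕ-Solver
open import Data.Integer as ℤ using (ℤ; +_; _+_; _*_; -_; _-_; _/ℕ_; 0ℤ; 1ℤ; -1ℤ)
import Data.Integer.Properties as ℤ
open import Data.Integer.Tactic.RingSolver using (solve-∀)
open import Data.Product using (_×_; _,_)
open import Data.Sum using (inj₁; inj₂)
open import Function using (_∘_)
open import Relation.Nullary using (yes; no)
open import Relation.Binary.PropositionalEquality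
open ≡-Reasoning

sumTo-cong : ∀ n {f g : ℕ → ℤ} → (∀ k → k ℕ.≤ n → f k ≡ g k) → sumTo n f ≡ sumTo n g
sumTo-cong zero    f≗g = f≗g 0 z≤n
sumTo-cong (suc n) f≗g =
  cong₂ _+_ (sumTo-cong n (λ k k≤n → f≗g k (ℕ.m≤n⇒m≤1+n k≤n))) (f≗g (suc n) ℕ.≤-refl)

sumTo-+ : ∀ n (f g : ℕ → ℤ) → sumTo n (λ k → f k + g k) ≡ sumTo n f + sumTo n g
sumTo-+ zero    f g = refl
sumTo-+ (suc n) f g = begin
  sumTo n (λ k → f k + g k) + (f (suc n) + g (suc n))
    ≡⟨ cong (_+ (f (suc n) + g (suc n))) (sumTo-+ n f g) ⟩
  sumTo n f + sumTo n g + (f (suc n) + g (suc n))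
    ≡⟨ interchange (sumTo n f) (sumTo n g) (f (suc n)) (g (suc n)) ⟩
  sumTo n f + f (suc n) + (sumTo n g + g (suc n)) ∎
  where
  interchange : ∀ a b c d → a + b + (c + d) ≡ a + c + (b + d)
  interchange = solve-∀

*-distribˡ-sumTo : ∀ n c (f : ℕ → ℤ) → c * sumTo n f ≡ sumTo n (λ k → c * f k)
*-distribˡ-sumTo zero    c f = refl
*-distribˡ-sumTo (suc n) c f =
  trans (ℤ.*-distribˡ-+ c (sumTo n f) (f (suc n))) (cong (_+ c * f (suc n)) (*-distribˡ-sumTo n c f))

sumTo-sucˡ : ∀ n (f : ℕ → ℤ) → sumTo (suc n) f ≡ f 0 + sumTo n (f ∘ suc)
sumTo-sucˡ zero    f = refl
sumTo-sucˡ (suc n) f = trans (cong (_+ f (suc (suc n))) (sumTo-sucˡ n f)) (ℤ.+-assoc (f 0) _ _)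

sumTo-swap : ∀ m n (f : ℕ → ℕ → ℤ) →
  sumTo m (λ i → sumTo n (f i)) ≡ sumTo n (λ j → sumTo m (λ i → f i j))
sumTo-swap zero    n f = refl
sumTo-swap (suc m) n f = begin
  sumTo m (λ i → sumTo n (f i)) + sumTo n (f (suc m))
    ≡⟨ cong (_+ sumTo n (f (suc m))) (sumTo-swap m n f) ⟩
  sumTo n (λ j → sumTo m (λ i → f i j)) + sumTo n (f (suc m))
    ≡⟨ sumTo-+ n _ _ ⟨
  sumTo n (λ j → sumTo (suc m) (λ i → f i j)) ∎

sumTo-reverse : ∀ n (f : ℕ → ℤ) → sumTo n f ≡ sumTo n (λ k → f (n ℕ.∸ k))
sumTo-reverse zero    f = refl
sumTo-reverse (suc n) f = begin
  sumTo n f + f (suc n)                        ≡⟨ cong (_+ f (suc n)) (sumTo-reverse n f) ⟩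
  sumTo n (λ k → f (n ℕ.∸ k)) + f (suc n)      ≡⟨ ℤ.+-comm _ (f (suc n)) ⟩
  f (suc n) + sumTo n (λ k → f (n ℕ.∸ k))      ≡⟨ sumTo-sucˡ n (λ k → f (suc n ℕ.∸ k)) ⟨
  sumTo (suc n) (λ k → f (suc n ℕ.∸ k))        ∎

sumTo-extend : ∀ {m n} (f : ℕ → ℤ) → m ℕ.≤ n → (∀ k → m ℕ.< k → f k ≡ 0ℤ) →
  sumTo m f ≡ sumTo n f
sumTo-extend {m} f m≤n f>m≡0 = go (ℕ.≤⇒≤′ m≤n)
  where
  go : ∀ {n} → m ≤′ n → sumTo m f ≡ sumTo n f
  go ≤′-refl = refl
  go (≤′-step {n} m≤′n) = begin
    sumTo m f              ≡⟨ go m≤′n ⟩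
    sumTo n f              ≡⟨ ℤ.+-identityʳ (sumTo n f) ⟨
    sumTo n f + 0ℤ         ≡⟨ cong (_+_ (sumTo n f)) (f>m≡0 (suc n) (s≤s (ℕ.≤′⇒≤ m≤′n))) ⟨
    sumTo n f + f (suc n)  ∎

sumTo-truncate : ∀ m n (f : ℕ → ℤ) →
  (∀ k → m ℕ.< k → f k ≡ 0ℤ) → (∀ k → n ℕ.< k → f k ≡ 0ℤ) → sumTo m f ≡ sumTo n f
sumTo-truncate m n f f>m≡0 f>n≡0 with ℕ.≤-total m n
... | inj₁ m≤n = sumTo-extend f m≤n f>m≡0
... | inj₂ n≤m = sym (sumTo-extend f n≤m f>n≡0)

sumTo-offset : ∀ r n (f : ℕ → ℤ) → (∀ k → k ℕ.< r → f k ≡ 0ℤ) →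
  sumTo (r ℕ.+ n) f ≡ sumTo n (λ i → f (r ℕ.+ i))
sumTo-offset zero    n f _      = refl
sumTo-offset (suc r) n f f<r≡0 = begin
  sumTo (suc (r ℕ.+ n)) f                     ≡⟨ sumTo-sucˡ (r ℕ.+ n) f ⟩
  f 0 + sumTo (r ℕ.+ n) (f ∘ suc)
    ≡⟨ cong₂ _+_ (f<r≡0 0 (s≤s z≤n)) (sumTo-offset r n (f ∘ suc) (λ k k<r → f<r≡0 (suc k) (s≤s k<r))) ⟩
  0ℤ + sumTo n (λ i → f (suc (r ℕ.+ i)))      ≡⟨ ℤ.+-identityˡ _ ⟩
  sumTo n (λ i → f (suc r ℕ.+ i))             ∎

sign-suc : ∀ j → sign (suc j) ≡ - sign j
sign-suc zero          = refl
sign-suc (suc zero)    = refl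
sign-suc (suc (suc j)) = sign-suc j

sign*sign≡1 : ∀ j → sign j * sign j ≡ 1ℤ
sign*sign≡1 zero          = refl
sign*sign≡1 (suc zero)    = refl
sign*sign≡1 (suc (suc j)) = sign*sign≡1 j

sign[n]*sign[n∸k]≡sign[k] : ∀ {k n} → k ℕ.≤ n → sign n * sign (n ℕ.∸ k) ≡ sign k
sign[n]*sign[n∸k]≡sign[k] {n = n} z≤n = sign*sign≡1 n
sign[n]*sign[n∸k]≡sign[k] {suc k} {suc n} (s≤s k≤n) = begin
  sign (suc n) * sign (n ℕ.∸ k)   ≡⟨ cong (_* sign (n ℕ.∸ k)) (sign-suc n) ⟩
  - sign n * sign (n ℕ.∸ k)       ≡⟨ ℤ.neg-distribˡ-* (sign n) _ ⟨
  - (sign n * sign (n ℕ.∸ k))     ≡⟨ cong -_ (sign[n]*sign[n∸k]≡sign[k] k≤n) ⟩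
  - sign k                        ≡⟨ sign-suc k ⟨
  sign (suc k)                    ∎

nCk*[k!*[n∸k]!]≡n! : ∀ {n k} → k ℕ.≤ n → (n C k) ℕ.* (k ! ℕ.* (n ℕ.∸ k) !) ≡ n !
nCk*[k!*[n∸k]!]≡n! {n} {k} k≤n = begin
  (n C k) ℕ.* (k ! ℕ.* (n ℕ.∸ k) !)
    ≡⟨ cong (ℕ._* (k ! ℕ.* (n ℕ.∸ k) !)) (nCk≡n!/k![n-k]! k≤n) ⟩
  n ! ℕ./ (k ! ℕ.* (n ℕ.∸ k) !) ℕ.* (k ! ℕ.* (n ℕ.∸ k) !)
    ≡⟨ m/n*n≡m (k![n∸k]!∣n! k≤n) ⟩
  n ! ∎
  where instance _ = ℕ.m*n≢0 (k !) ((n ℕ.∸ k) !) {{k !≢0}} {{(n ℕ.∸ k) !≢0}}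

[a+b]Ca*[a!*b!]≡[a+b]! : ∀ a b → ((a ℕ.+ b) C a) ℕ.* (a ! ℕ.* b !) ≡ (a ℕ.+ b) !
[a+b]Ca*[a!*b!]≡[a+b]! a b =
  subst (λ c → ((a ℕ.+ b) C a) ℕ.* (a ! ℕ.* c !) ≡ (a ℕ.+ b) !) (ℕ.m+n∸m≡n a b)
        (nCk*[k!*[n∸k]!]≡n! (ℕ.m≤m+n a b))

nCk*kCr≡nCr*[n∸r]C[k∸r] : ∀ r R i →
  ((r ℕ.+ R) C (r ℕ.+ i)) ℕ.* ((r ℕ.+ i) C r) ≡ ((r ℕ.+ R) C r) ℕ.* (R C i)
nCk*kCr≡nCr*[n∸r]C[k∸r] r R i with i ℕ.≤? R
... | no i≰R = begin
  ((r ℕ.+ R) C (r ℕ.+ i)) ℕ.* ((r ℕ.+ i) C r)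
    ≡⟨ cong (ℕ._* ((r ℕ.+ i) C r)) (k>n⇒nCk≡0 (ℕ.+-monoʳ-< r R<i)) ⟩
  0                                            ≡⟨ ℕ.*-zeroʳ ((r ℕ.+ R) C r) ⟨
  ((r ℕ.+ R) C r) ℕ.* 0                        ≡⟨ cong (((r ℕ.+ R) C r) ℕ.*_) (k>n⇒nCk≡0 R<i) ⟨
  ((r ℕ.+ R) C r) ℕ.* (R C i)                  ∎
  where R<i = ℕ.≰⇒> i≰R
... | yes i≤R with ℕ.m≤n⇒∃[o]m+o≡n i≤R
...   | d , refl = ℕ.*-cancelʳ-≡ _ _ (r ! ℕ.* (i ! ℕ.* d !)) {{r!i!d!≢0}} (trans lhs (sym rhs))
  where
  r!i!d!≢0 = ℕ.m*n≢0 (r !) (i ! ℕ.* d !) {{r !≢0}} {{ℕ.m*n≢0 (i !) (d !) {{i !≢0}} {{d !≢0}}}}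
  regroupˡ : ∀ x y a b c → x ℕ.* y ℕ.* (a ℕ.* (b ℕ.* c)) ≡ x ℕ.* (y ℕ.* (a ℕ.* b) ℕ.* c)
  regroupˡ = ℕ-Solver.solve-∀
  regroupʳ : ∀ x y a b c → x ℕ.* y ℕ.* (a ℕ.* (b ℕ.* c)) ≡ x ℕ.* (a ℕ.* (y ℕ.* (b ℕ.* c)))
  regroupʳ = ℕ-Solver.solve-∀
  X = (r ℕ.+ (i ℕ.+ d)) C (r ℕ.+ i)
  Y = (r ℕ.+ (i ℕ.+ d)) C r
  lhs : X ℕ.* ((r ℕ.+ i) C r) ℕ.* (r ! ℕ.* (i ! ℕ.* d !)) ≡ (r ℕ.+ (i ℕ.+ d)) !
  lhs = begin
    X ℕ.* ((r ℕ.+ i) C r) ℕ.* (r ! ℕ.* (i ! ℕ.* d !))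
      ≡⟨ regroupˡ X ((r ℕ.+ i) C r) (r !) (i !) (d !) ⟩
    X ℕ.* (((r ℕ.+ i) C r) ℕ.* (r ! ℕ.* i !) ℕ.* d !)
      ≡⟨ cong (λ y → X ℕ.* (y ℕ.* d !)) ([a+b]Ca*[a!*b!]≡[a+b]! r i) ⟩
    X ℕ.* ((r ℕ.+ i) ! ℕ.* d !)
      ≡⟨ cong (λ N → (N C (r ℕ.+ i)) ℕ.* ((r ℕ.+ i) ! ℕ.* d !)) (ℕ.+-assoc r i d) ⟨
    ((r ℕ.+ i ℕ.+ d) C (r ℕ.+ i)) ℕ.* ((r ℕ.+ i) ! ℕ.* d !)
      ≡⟨ [a+b]Ca*[a!*b!]≡[a+b]! (r ℕ.+ i) d ⟩
    (r ℕ.+ i ℕ.+ d) !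
      ≡⟨ cong _! (ℕ.+-assoc r i d) ⟩
    (r ℕ.+ (i ℕ.+ d)) ! ∎
  rhs : Y ℕ.* ((i ℕ.+ d) C i) ℕ.* (r ! ℕ.* (i ! ℕ.* d !)) ≡ (r ℕ.+ (i ℕ.+ d)) !
  rhs = begin
    Y ℕ.* ((i ℕ.+ d) C i) ℕ.* (r ! ℕ.* (i ! ℕ.* d !))
      ≡⟨ regroupʳ Y ((i ℕ.+ d) C i) (r !) (i !) (d !) ⟩
    Y ℕ.* (r ! ℕ.* (((i ℕ.+ d) C i) ℕ.* (i ! ℕ.* d !)))
      ≡⟨ cong (λ y → Y ℕ.* (r ! ℕ.* y)) ([a+b]Ca*[a!*b!]≡[a+b]! i d) ⟩
    Y ℕ.* (r ! ℕ.* (i ℕ.+ d) !)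
      ≡⟨ [a+b]Ca*[a!*b!]≡[a+b]! r (i ℕ.+ d) ⟩
    (r ℕ.+ (i ℕ.+ d)) ! ∎

k>n⇒binom≡0 : ∀ {n k} → n ℕ.< k → binom n k ≡ 0ℤ
k>n⇒binom≡0 n<k = cong +_ (k>n⇒nCk≡0 n<k)

binom-pascal : ∀ n k → binom (suc n) (suc k) ≡ binom n k + binom n (suc k)
binom-pascal n k = trans (cong +_ (sym (nCk+nC[k+1]≡[n+1]C[k+1] n k))) (ℤ.pos-+ (n C k) (n C suc k))

binom-sym : ∀ a b → binom (a ℕ.+ b) a ≡ binom (a ℕ.+ b) b
binom-sym a b = cong +_ (trans (nCk≡nC[n∸k] (ℕ.m≤m+n a b)) (cong ((a ℕ.+ b) C_) (ℕ.m+n∸m≡n a b)))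

binom-subset : ∀ r R i → binom (r ℕ.+ R) (r ℕ.+ i) * binom (r ℕ.+ i) r ≡ binom (r ℕ.+ R) r * binom R i
binom-subset r R i = begin
  binom (r ℕ.+ R) (r ℕ.+ i) * binom (r ℕ.+ i) r        ≡⟨ ℤ.pos-* ((r ℕ.+ R) C (r ℕ.+ i)) _ ⟨
  + (((r ℕ.+ R) C (r ℕ.+ i)) ℕ.* ((r ℕ.+ i) C r))     ≡⟨ cong +_ (nCk*kCr≡nCr*[n∸r]C[k∸r] r R i) ⟩
  + (((r ℕ.+ R) C r) ℕ.* (R C i))                     ≡⟨ ℤ.pos-* ((r ℕ.+ R) C r) _ ⟩
  binom (r ℕ.+ R) r * binom R i                       ∎

binom-absorb : ∀ n k → + suc k * binom (suc n) (suc k) ≡ + suc n * binom n k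
binom-absorb n k = begin
  + suc k * binom (suc n) (suc k)             ≡⟨ ℤ.*-comm (+ suc k) _ ⟩
  binom (suc n) (suc k) * + suc k             ≡⟨ cong (λ c → binom (suc n) (suc k) * + c) (nC1≡n (suc k)) ⟨
  binom (suc n) (suc k) * binom (suc k) 1     ≡⟨ binom-subset 1 n k ⟩
  binom (suc n) 1 * binom n k                 ≡⟨ cong (λ c → + c * binom n k) (nC1≡n (suc n)) ⟩
  + suc n * binom n k                         ∎

Δ : ℕ → (ℕ → ℤ) → ℤ
Δ j g = sumTo j (λ p → sign (j ℕ.∸ p) * binom j p * g p)

Δ-cong : ∀ j {f g : ℕ → ℤ} → (∀ p → p ℕ.≤ j → f p ≡ g p) → Δ j f ≡ Δ j g
Δ-cong j f≗g = sumTo-cong j (λ p p≤j → cong (sign (j ℕ.∸ p) * binom j p *_) (f≗g p p≤j))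

Δ-+ : ∀ j (f g : ℕ → ℤ) → Δ j (λ p → f p + g p) ≡ Δ j f + Δ j g
Δ-+ j f g = trans (sumTo-cong j (λ p _ → ℤ.*-distribˡ-+ (sign (j ℕ.∸ p) * binom j p) (f p) (g p))) (sumTo-+ j _ _)

Δ-* : ∀ j c (f : ℕ → ℤ) → Δ j (λ p → c * f p) ≡ c * Δ j f
Δ-* j c f = trans (sumTo-cong j (λ p _ → swap (sign (j ℕ.∸ p) * binom j p) c (f p))) (sym (*-distribˡ-sumTo j c _))
  where
  swap : ∀ a c x → a * (c * x) ≡ c * (a * x)
  swap = solve-∀

Δ-extend : ∀ {k n} g → k ℕ.≤ n → Δ k g ≡ sumTo n (λ p → sign (k ℕ.∸ p) * binom k p * g p)
Δ-extend {k} g k≤n = sumTo-extend _ k≤n above-k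
  where
  zero-middle : ∀ s x → s * 0ℤ * x ≡ 0ℤ
  zero-middle = solve-∀
  above-k : ∀ p → k ℕ.< p → sign (k ℕ.∸ p) * binom k p * g p ≡ 0ℤ
  above-k p k<p = trans (cong (λ b → sign (k ℕ.∸ p) * b * g p) (k>n⇒binom≡0 k<p))
                        (zero-middle (sign (k ℕ.∸ p)) (g p))

neg-Δ : ∀ j g → - Δ j g ≡ sumTo (suc j) (λ p → sign (suc j ℕ.∸ p) * binom j p * g p)
neg-Δ j g = begin
  - Δ j g                                                    ≡⟨ ℤ.-1*i≡-i (Δ j g) ⟨
  -1ℤ * Δ j g                                                ≡⟨ *-distribˡ-sumTo j -1ℤ _ ⟩
  sumTo j (λ p → -1ℤ * (sign (j ℕ.∸ p) * binom j p * g p))  ≡⟨ sumTo-cong j negate ⟩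
  sumTo j t                                                  ≡⟨ sumTo-extend t (ℕ.n≤1+n j) t>j≡0 ⟩
  sumTo (suc j) t                                            ∎
  where
  t = λ p → sign (suc j ℕ.∸ p) * binom j p * g p
  neg-assoc : ∀ s b x → - (s * b * x) ≡ - s * b * x
  neg-assoc = solve-∀
  zero-middle : ∀ s x → s * 0ℤ * x ≡ 0ℤ
  zero-middle = solve-∀
  negate : ∀ p → p ℕ.≤ j → -1ℤ * (sign (j ℕ.∸ p) * binom j p * g p) ≡ t p
  negate p p≤j = begin
    -1ℤ * (sign (j ℕ.∸ p) * binom j p * g p)   ≡⟨ ℤ.-1*i≡-i _ ⟩
    - (sign (j ℕ.∸ p) * binom j p * g p)       ≡⟨ neg-assoc (sign (j ℕ.∸ p)) (binom j p) (g p) ⟩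
    - sign (j ℕ.∸ p) * binom j p * g p         ≡⟨ cong (λ s → s * binom j p * g p) (sign-suc (j ℕ.∸ p)) ⟨
    sign (suc (j ℕ.∸ p)) * binom j p * g p     ≡⟨ cong (λ e → sign e * binom j p * g p) (ℕ.+-∸-assoc 1 p≤j) ⟨
    t p                                        ∎
  t>j≡0 : ∀ p → j ℕ.< p → t p ≡ 0ℤ
  t>j≡0 p j<p = trans (cong (λ b → sign (suc j ℕ.∸ p) * b * g p) (k>n⇒binom≡0 j<p))
                      (zero-middle (sign (suc j ℕ.∸ p)) (g p))

Δ-suc : ∀ j g → Δ (suc j) g ≡ Δ j (g ∘ suc) - Δ j g
Δ-suc j g = begin
  Δ (suc j) g
    ≡⟨ sumTo-sucˡ j _ ⟩
  sign (suc j) * 1ℤ * g 0 + sumTo j (λ q → sign (j ℕ.∸ q) * binom (suc j) (suc q) * g (suc q))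
    ≡⟨ cong (_+_ (sign (suc j) * 1ℤ * g 0)) (trans (sumTo-cong j (λ q _ → pascal-split q)) (sumTo-+ j _ _)) ⟩
  sign (suc j) * 1ℤ * g 0 + (Δ j (g ∘ suc) + sumTo j B)
    ≡⟨ left-commute (sign (suc j) * 1ℤ * g 0) (Δ j (g ∘ suc)) (sumTo j B) ⟩
  Δ j (g ∘ suc) + (sign (suc j) * 1ℤ * g 0 + sumTo j B)
    ≡⟨ cong (_+_ (Δ j (g ∘ suc))) (trans (neg-Δ j g) (sumTo-sucˡ j _)) ⟨
  Δ j (g ∘ suc) - Δ j g ∎
  where
  B = λ q → sign (j ℕ.∸ q) * binom j (suc q) * g (suc q)
  left-commute : ∀ a b c → a + (b + c) ≡ b + (a + c)
  left-commute = solve-∀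
  distrib : ∀ s x y z → s * (x + y) * z ≡ s * x * z + s * y * z
  distrib = solve-∀
  pascal-split : ∀ q → sign (j ℕ.∸ q) * binom (suc j) (suc q) * g (suc q)
                     ≡ sign (j ℕ.∸ q) * binom j q * g (suc q) + B q
  pascal-split q = trans (cong (λ b → sign (j ℕ.∸ q) * b * g (suc q)) (binom-pascal j q))
                         (distrib (sign (j ℕ.∸ q)) (binom j q) (binom j (suc q)) (g (suc q)))

Δ-absorb : ∀ j g → Δ (suc j) (λ p → + p * g p) ≡ + suc j * Δ j (g ∘ suc)
Δ-absorb j g = begin
  Δ (suc j) (λ p → + p * g p)
    ≡⟨ sumTo-sucˡ j _ ⟩
  sign (suc j) * 1ℤ * (0ℤ * g 0) + sumTo j (λ q → sign (j ℕ.∸ q) * binom (suc j) (suc q) * (+ suc q * g (suc q)))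
    ≡⟨ cong₂ _+_ (first-term-vanishes (sign (suc j)) (g 0)) (sumTo-cong j (λ q _ → absorb q)) ⟩
  0ℤ + sumTo j (λ q → + suc j * (sign (j ℕ.∸ q) * binom j q * g (suc q)))
    ≡⟨ ℤ.+-identityˡ _ ⟩
  sumTo j (λ q → + suc j * (sign (j ℕ.∸ q) * binom j q * g (suc q)))
    ≡⟨ *-distribˡ-sumTo j (+ suc j) _ ⟨
  + suc j * Δ j (g ∘ suc) ∎
  where
  first-term-vanishes : ∀ s x → s * 1ℤ * (0ℤ * x) ≡ 0ℤ
  first-term-vanishes = solve-∀
  regroup : ∀ s b k x → s * b * (k * x) ≡ s * (k * b) * x
  regroup = solve-∀
  regroup′ : ∀ s n b x → s * (n * b) * x ≡ n * (s * b * x)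
  regroup′ = solve-∀
  absorb : ∀ q → sign (j ℕ.∸ q) * binom (suc j) (suc q) * (+ suc q * g (suc q))
               ≡ + suc j * (sign (j ℕ.∸ q) * binom j q * g (suc q))
  absorb q = begin
    sign (j ℕ.∸ q) * binom (suc j) (suc q) * (+ suc q * g (suc q))
      ≡⟨ regroup (sign (j ℕ.∸ q)) (binom (suc j) (suc q)) (+ suc q) (g (suc q)) ⟩
    sign (j ℕ.∸ q) * (+ suc q * binom (suc j) (suc q)) * g (suc q)
      ≡⟨ cong (λ b → sign (j ℕ.∸ q) * b * g (suc q)) (binom-absorb j q) ⟩
    sign (j ℕ.∸ q) * (+ suc j * binom j q) * g (suc q)
      ≡⟨ regroup′ (sign (j ℕ.∸ q)) (+ suc j) (binom j q) (g (suc q)) ⟩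
    + suc j * (sign (j ℕ.∸ q) * binom j q * g (suc q)) ∎

Δ-leibniz : ∀ j v g → Δ (suc j) (λ p → + (v ℕ.+ p) * g p) ≡ + (v ℕ.+ suc j) * Δ (suc j) g + + suc j * Δ j g
Δ-leibniz j v g = begin
  Δ (suc j) (λ p → + (v ℕ.+ p) * g p)
    ≡⟨ Δ-cong (suc j) (λ p _ → trans (cong (_* g p) (ℤ.pos-+ v p)) (ℤ.*-distribʳ-+ (g p) (+ v) (+ p))) ⟩
  Δ (suc j) (λ p → + v * g p + + p * g p)
    ≡⟨ Δ-+ (suc j) _ _ ⟩
  Δ (suc j) (λ p → + v * g p) + Δ (suc j) (λ p → + p * g p)
    ≡⟨ cong₂ _+_ (Δ-* (suc j) (+ v) g) (Δ-absorb j g) ⟩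
  + v * Δ (suc j) g + + suc j * Δ j (g ∘ suc)
    ≡⟨ cong (λ x → + v * Δ (suc j) g + + suc j * x) (sub-add (Δ j (g ∘ suc)) (Δ j g)) ⟩
  + v * Δ (suc j) g + + suc j * ((Δ j (g ∘ suc) - Δ j g) + Δ j g)
    ≡⟨ cong (λ x → + v * Δ (suc j) g + + suc j * (x + Δ j g)) (Δ-suc j g) ⟨
  + v * Δ (suc j) g + + suc j * (Δ (suc j) g + Δ j g)
    ≡⟨ collect (+ v) (+ suc j) (Δ (suc j) g) (Δ j g) ⟩
  (+ v + + suc j) * Δ (suc j) g + + suc j * Δ j g
    ≡⟨ cong (λ c → c * Δ (suc j) g + + suc j * Δ j g) (ℤ.pos-+ v (suc j)) ⟨
  + (v ℕ.+ suc j) * Δ (suc j) g + + suc j * Δ j g ∎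
  where
  sub-add : ∀ x y → x ≡ (x - y) + y
  sub-add = solve-∀
  collect : ∀ v k x y → v * x + k * (x + y) ≡ (v + k) * x + k * y
  collect = solve-∀

Δ-binomial : ∀ R c K → Δ R (λ i → binom (c ℕ.+ i) (K ℕ.+ R)) ≡ binom c K
Δ-binomial zero c K = trans (ℤ.*-identityˡ _) (cong₂ binom (ℕ.+-identityʳ c) (ℕ.+-identityʳ K))
Δ-binomial (suc R) c K = begin
  Δ (suc R) (λ i → binom (c ℕ.+ i) (K ℕ.+ suc R))
    ≡⟨ Δ-suc R _ ⟩
  Δ R (λ i → binom (c ℕ.+ suc i) (K ℕ.+ suc R)) - Δ R (λ i → binom (c ℕ.+ i) (K ℕ.+ suc R))
    ≡⟨ cong₂ _-_ (Δ-cong R (λ i _ → cong₂ binom (ℕ.+-suc c i) (ℕ.+-suc K R)))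
                 (Δ-cong R (λ i _ → cong (binom (c ℕ.+ i)) (ℕ.+-suc K R))) ⟩
  Δ R (λ i → binom (suc c ℕ.+ i) (suc K ℕ.+ R)) - Δ R (λ i → binom (c ℕ.+ i) (suc K ℕ.+ R))
    ≡⟨ cong₂ _-_ (Δ-binomial R (suc c) (suc K)) (Δ-binomial R c (suc K)) ⟩
  binom (suc c) (suc K) - binom c (suc K)
    ≡⟨ cong (_- binom c (suc K)) (binom-pascal c K) ⟩
  binom c K + binom c (suc K) - binom c (suc K)
    ≡⟨ cancel (binom c K) (binom c (suc K)) ⟩
  binom c K ∎
  where
  cancel : ∀ x y → x + y - y ≡ x
  cancel = solve-∀

sign*Δ≡alternating-sum : ∀ k f → sign k * Δ k f ≡ sumTo k (λ p → sign p * binom k p * f p)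
sign*Δ≡alternating-sum k f = trans (*-distribˡ-sumTo k (sign k) _) (sumTo-cong k term)
  where
  reassoc : ∀ s t b x → s * (t * b * x) ≡ s * t * b * x
  reassoc = solve-∀
  term : ∀ p → p ℕ.≤ k → sign k * (sign (k ℕ.∸ p) * binom k p * f p) ≡ sign p * binom k p * f p
  term p p≤k = trans (reassoc (sign k) (sign (k ℕ.∸ p)) (binom k p) (f p))
                     (cong (λ s → s * binom k p * f p) (sign[n]*sign[n∸k]≡sign[k] p≤k))

Δ-reflect : ∀ k f → Δ k (λ r → f (k ℕ.∸ r)) ≡ sign k * Δ k f
Δ-reflect k f = begin
  Δ k (λ r → f (k ℕ.∸ r))
    ≡⟨ sumTo-reverse k _ ⟩
  sumTo k (λ p → sign (k ℕ.∸ (k ℕ.∸ p)) * binom k (k ℕ.∸ p) * f (k ℕ.∸ (k ℕ.∸ p)))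
    ≡⟨ sumTo-cong k term ⟩
  sumTo k (λ p → sign p * binom k p * f p)
    ≡⟨ sign*Δ≡alternating-sum k f ⟨
  sign k * Δ k f ∎
  where
  term : ∀ p → p ℕ.≤ k →
    sign (k ℕ.∸ (k ℕ.∸ p)) * binom k (k ℕ.∸ p) * f (k ℕ.∸ (k ℕ.∸ p)) ≡ sign p * binom k p * f p
  term p p≤k = trans
    (cong (λ b → sign (k ℕ.∸ (k ℕ.∸ p)) * b * f (k ℕ.∸ (k ℕ.∸ p))) (cong +_ (nCk≡nC[n∸k] (ℕ.m∸n≤m k p))))
    (cong (λ q → sign q * binom k q * f q) (ℕ.m∸[m∸n]≡n p≤k))

shiftedPow : ℕ → ℕ → ℕ → ℤ
shiftedPow v m p = + ((v ℕ.+ p) ℕ.^ m)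

-- rStirling v m j is the v-Stirling number {m+v over j+v}_v.
rStirling : ℕ → ℕ → ℕ → ℕ
rStirling v m       zero    = v ℕ.^ m
rStirling v zero    (suc j) = 0
rStirling v (suc m) (suc j) = (v ℕ.+ suc j) ℕ.* rStirling v m (suc j) ℕ.+ rStirling v m j

Δ-shiftedPow : ∀ v m j → Δ j (shiftedPow v m) ≡ + (rStirling v m j ℕ.* j !)
Δ-shiftedPow v m zero =
  trans (ℤ.*-identityˡ _) (cong +_ (trans (cong (ℕ._^ m) (ℕ.+-identityʳ v)) (sym (ℕ.*-identityʳ (v ℕ.^ m)))))
Δ-shiftedPow v zero (suc j) = begin
  Δ (suc j) (λ _ → 1ℤ)                        ≡⟨ Δ-suc j (λ _ → 1ℤ) ⟩
  Δ j (λ _ → 1ℤ) - Δ j (λ _ → 1ℤ)            ≡⟨ ℤ.+-inverseʳ (Δ j (λ _ → 1ℤ)) ⟩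
  0ℤ                                          ≡⟨ cong +_ (ℕ.*-zeroˡ (suc j !)) ⟨
  + (0 ℕ.* suc j !)                           ∎
Δ-shiftedPow v (suc m) (suc j) = begin
  Δ (suc j) (shiftedPow v (suc m))
    ≡⟨ Δ-cong (suc j) (λ p _ → ℤ.pos-* (v ℕ.+ p) _) ⟩
  Δ (suc j) (λ p → + (v ℕ.+ p) * shiftedPow v m p)
    ≡⟨ Δ-leibniz j v (shiftedPow v m) ⟩
  + w * Δ (suc j) (shiftedPow v m) + + suc j * Δ j (shiftedPow v m)
    ≡⟨ cong₂ (λ x y → + w * x + + suc j * y) (Δ-shiftedPow v m (suc j)) (Δ-shiftedPow v m j) ⟩
  + w * + (S₁ ℕ.* suc j !) + + suc j * + (S₀ ℕ.* j !)
    ≡⟨ cong₂ _+_ (ℤ.pos-* w _) (ℤ.pos-* (suc j) _) ⟨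
  + (w ℕ.* (S₁ ℕ.* suc j !)) + + (suc j ℕ.* (S₀ ℕ.* j !))
    ≡⟨ ℤ.pos-+ (w ℕ.* (S₁ ℕ.* suc j !)) _ ⟨
  + (w ℕ.* (S₁ ℕ.* suc j !) ℕ.+ suc j ℕ.* (S₀ ℕ.* j !))
    ≡⟨ cong +_ (factor w (suc j) (j !) S₁ S₀) ⟩
  + (rStirling v (suc m) (suc j) ℕ.* suc j !) ∎
  where
  w = v ℕ.+ suc j
  S₁ = rStirling v m (suc j)
  S₀ = rStirling v m j
  factor : ∀ w k f x y → w ℕ.* (x ℕ.* (k ℕ.* f)) ℕ.+ k ℕ.* (y ℕ.* f) ≡ (w ℕ.* x ℕ.+ y) ℕ.* (k ℕ.* f)
  factor = ℕ-Solver.solve-∀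

rStirling-vanish : ∀ v {m j} → m ℕ.< j → rStirling v m j ≡ 0
rStirling-vanish v {zero}  {suc j} _ = refl
rStirling-vanish v {suc m} {suc j} (s≤s m<j) = trans
  (cong₂ (λ x y → (v ℕ.+ suc j) ℕ.* x ℕ.+ y) (rStirling-vanish v (ℕ.m<n⇒m<1+n m<j)) (rStirling-vanish v m<j))
  (cong (ℕ._+ 0) (ℕ.*-zeroʳ (v ℕ.+ suc j)))

Δ-shiftedPow-vanish : ∀ v {m j} → m ℕ.< j → Δ j (shiftedPow v m) ≡ 0ℤ
Δ-shiftedPow-vanish v {m} {j} m<j = trans (Δ-shiftedPow v m j) (cong (λ s → + (s ℕ.* j !)) (rStirling-vanish v m<j))

j!*rStirling≡Δ : ∀ v m j → + (j !) * + rStirling v m j ≡ Δ j (shiftedPow v m)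
j!*rStirling≡Δ v m j = begin
  + (j !) * + rStirling v m j        ≡⟨ ℤ.pos-* (j !) _ ⟨
  + (j ! ℕ.* rStirling v m j)        ≡⟨ cong +_ (ℕ.*-comm (j !) _) ⟩
  + (rStirling v m j ℕ.* j !)        ≡⟨ Δ-shiftedPow v m j ⟨
  Δ j (shiftedPow v m)               ∎

Δ-shiftedPow/ℕj! : ∀ v m j → (Δ j (shiftedPow v m) /ℕ j !) {{j !≢0}} ≡ + rStirling v m j
Δ-shiftedPow/ℕj! v m j = begin
  Δ j (shiftedPow v m) /ℕ j !             ≡⟨ cong (_/ℕ j !) (Δ-shiftedPow v m j) ⟩
  + (rStirling v m j ℕ.* j !) /ℕ j !      ≡⟨ cong +_ (m*n/n≡m (rStirling v m j) (j !)) ⟩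
  + rStirling v m j                       ∎
  where instance _ = j !≢0

stirling2≡rStirling : ∀ m k → stirling2 m k ≡ + rStirling 0 m k
stirling2≡rStirling m k = Δ-shiftedPow/ℕj! 0 m k

vStirling≡rStirling : ∀ m n k → vStirling m n k ≡ + rStirling (n ℕ.∸ k) m k
vStirling≡rStirling m n k = Δ-shiftedPow/ℕj! (n ℕ.∸ k) m k

Δ-shiftedPow-reflect : ∀ m {k n} → k ℕ.≤ n →
  sign k * Δ k (shiftedPow (n ℕ.∸ k) m) ≡ Δ k (λ r → + ((n ℕ.∸ r) ℕ.^ m))
Δ-shiftedPow-reflect m {k} {n} k≤n = begin
  sign k * Δ k (shiftedPow (n ℕ.∸ k) m)
    ≡⟨ Δ-reflect k (shiftedPow (n ℕ.∸ k) m) ⟨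
  Δ k (λ r → + ((n ℕ.∸ k ℕ.+ (k ℕ.∸ r)) ℕ.^ m))
    ≡⟨ Δ-cong k (λ r r≤k → cong (λ e → + (e ℕ.^ m)) (n∸k+[k∸r]≡n∸r r≤k)) ⟩
  Δ k (λ r → + ((n ℕ.∸ r) ℕ.^ m)) ∎
  where
  n∸k+[k∸r]≡n∸r : ∀ {r} → r ℕ.≤ k → n ℕ.∸ k ℕ.+ (k ℕ.∸ r) ≡ n ℕ.∸ r
  n∸k+[k∸r]≡n∸r {r} r≤k = trans (sym (ℕ.+-∸-assoc (n ℕ.∸ k) r≤k)) (cong (ℕ._∸ r) (ℕ.m∸n+n≡m k≤n))

sumTo-binom-subset : ∀ r R (h : ℕ → ℤ) →
  sumTo (r ℕ.+ R) (λ k → sign (k ℕ.∸ r) * binom (r ℕ.+ R) k * binom k r * h k)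
    ≡ binom (r ℕ.+ R) r * (sign R * Δ R (λ i → h (r ℕ.+ i)))
sumTo-binom-subset r R h = begin
  sumTo (r ℕ.+ R) (λ k → sign (k ℕ.∸ r) * binom (r ℕ.+ R) k * binom k r * h k)
    ≡⟨ sumTo-offset r R (λ k → sign (k ℕ.∸ r) * binom (r ℕ.+ R) k * binom k r * h k) below-r ⟩
  sumTo R (λ i → sign ((r ℕ.+ i) ℕ.∸ r) * binom (r ℕ.+ R) (r ℕ.+ i) * binom (r ℕ.+ i) r * h (r ℕ.+ i))
    ≡⟨ sumTo-cong R (λ i _ → term i) ⟩
  sumTo R (λ i → binom (r ℕ.+ R) r * (sign i * binom R i * h (r ℕ.+ i)))
    ≡⟨ *-distribˡ-sumTo R (binom (r ℕ.+ R) r) (λ i → sign i * binom R i * h (r ℕ.+ i)) ⟨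
  binom (r ℕ.+ R) r * sumTo R (λ i → sign i * binom R i * h (r ℕ.+ i))
    ≡⟨ cong (binom (r ℕ.+ R) r *_) (sign*Δ≡alternating-sum R (λ i → h (r ℕ.+ i))) ⟨
  binom (r ℕ.+ R) r * (sign R * Δ R (λ i → h (r ℕ.+ i))) ∎
  where
  zero-right : ∀ s b x → s * b * 0ℤ * x ≡ 0ℤ
  zero-right = solve-∀
  below-r : ∀ k → k ℕ.< r → sign (k ℕ.∸ r) * binom (r ℕ.+ R) k * binom k r * h k ≡ 0ℤ
  below-r k k<r = trans (cong (λ b → sign (k ℕ.∸ r) * binom (r ℕ.+ R) k * b * h k) (k>n⇒binom≡0 k<r))
                        (zero-right (sign (k ℕ.∸ r)) (binom (r ℕ.+ R) k) (h k))
  regroup : ∀ s a b x → s * a * b * x ≡ s * (a * b) * x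
  regroup = solve-∀
  regroup′ : ∀ s c b x → s * (c * b) * x ≡ c * (s * b * x)
  regroup′ = solve-∀
  term : ∀ i → sign ((r ℕ.+ i) ℕ.∸ r) * binom (r ℕ.+ R) (r ℕ.+ i) * binom (r ℕ.+ i) r * h (r ℕ.+ i)
             ≡ binom (r ℕ.+ R) r * (sign i * binom R i * h (r ℕ.+ i))
  term i = begin
    sign ((r ℕ.+ i) ℕ.∸ r) * binom (r ℕ.+ R) (r ℕ.+ i) * binom (r ℕ.+ i) r * h (r ℕ.+ i)
      ≡⟨ regroup (sign ((r ℕ.+ i) ℕ.∸ r)) (binom (r ℕ.+ R) (r ℕ.+ i)) (binom (r ℕ.+ i) r) (h (r ℕ.+ i)) ⟩
    sign ((r ℕ.+ i) ℕ.∸ r) * (binom (r ℕ.+ R) (r ℕ.+ i) * binom (r ℕ.+ i) r) * h (r ℕ.+ i)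
      ≡⟨ cong₂ (λ e b → sign e * b * h (r ℕ.+ i)) (ℕ.m+n∸m≡n r i) (binom-subset r R i) ⟩
    sign i * (binom (r ℕ.+ R) r * binom R i) * h (r ℕ.+ i)
      ≡⟨ regroup′ (sign i) (binom (r ℕ.+ R) r) (binom R i) (h (r ℕ.+ i)) ⟩
    binom (r ℕ.+ R) r * (sign i * binom R i * h (r ℕ.+ i)) ∎

-- Up to sign, C(n,k) C(n+k,k) are the coefficients of the shifted Legendre polynomial of degree n.
legendre-kernel : ∀ {n p} → p ℕ.≤ n →
  sumTo n (λ k → sign (k ℕ.∸ p) * binom n k * binom k p * binom (k ℕ.+ n) k)
    ≡ sign (n ℕ.∸ p) * binom n p * binom (p ℕ.+ n) p
legendre-kernel {p = p} p≤n with ℕ.m≤n⇒∃[o]m+o≡n p≤n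
... | R , refl = begin
  sumTo (p ℕ.+ R) (λ k → sign (k ℕ.∸ p) * binom (p ℕ.+ R) k * binom k p * binom (k ℕ.+ (p ℕ.+ R)) k)
    ≡⟨ sumTo-binom-subset p R (λ k → binom (k ℕ.+ (p ℕ.+ R)) k) ⟩
  binom (p ℕ.+ R) p * (sign R * Δ R (λ i → binom (p ℕ.+ i ℕ.+ (p ℕ.+ R)) (p ℕ.+ i)))
    ≡⟨ cong (λ x → binom (p ℕ.+ R) p * (sign R * x))
            (trans (Δ-cong R (λ i _ → upper-index i)) (Δ-binomial R (p ℕ.+ (p ℕ.+ R)) p)) ⟩
  binom (p ℕ.+ R) p * (sign R * binom (p ℕ.+ (p ℕ.+ R)) p)
    ≡⟨ left-commute (binom (p ℕ.+ R) p) (sign R) _ ⟩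
  sign R * binom (p ℕ.+ R) p * binom (p ℕ.+ (p ℕ.+ R)) p
    ≡⟨ cong (λ e → sign e * binom (p ℕ.+ R) p * binom (p ℕ.+ (p ℕ.+ R)) p) (ℕ.m+n∸m≡n p R) ⟨
  sign (p ℕ.+ R ℕ.∸ p) * binom (p ℕ.+ R) p * binom (p ℕ.+ (p ℕ.+ R)) p ∎
  where
  left-commute : ∀ a s b → a * (s * b) ≡ s * a * b
  left-commute = solve-∀
  swap-last : ∀ a b c → a ℕ.+ b ℕ.+ c ≡ a ℕ.+ c ℕ.+ b
  swap-last = ℕ-Solver.solve-∀
  upper-index : ∀ i → binom (p ℕ.+ i ℕ.+ (p ℕ.+ R)) (p ℕ.+ i) ≡ binom (p ℕ.+ (p ℕ.+ R) ℕ.+ i) (p ℕ.+ R)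
  upper-index i = trans (binom-sym (p ℕ.+ i) (p ℕ.+ R)) (cong (λ N → binom N (p ℕ.+ R)) (swap-last p i (p ℕ.+ R)))

legendre-Δ : ∀ n g →
  sumTo n (λ k → binom n k * binom (k ℕ.+ n) k * Δ k g)
    ≡ sumTo n (λ p → sign (n ℕ.∸ p) * binom n p * binom (p ℕ.+ n) p * g p)
legendre-Δ n g = begin
  sumTo n (λ k → L k * Δ k g)
    ≡⟨ sumTo-cong n (λ k k≤n → trans (cong (L k *_) (Δ-extend g k≤n)) (*-distribˡ-sumTo n (L k) _)) ⟩
  sumTo n (λ k → sumTo n (λ p → L k * (sign (k ℕ.∸ p) * binom k p * g p)))
    ≡⟨ sumTo-swap n n (λ k p → L k * (sign (k ℕ.∸ p) * binom k p * g p)) ⟩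
  sumTo n (λ p → sumTo n (λ k → L k * (sign (k ℕ.∸ p) * binom k p * g p)))
    ≡⟨ sumTo-cong n coefficient ⟩
  sumTo n (λ p → sign (n ℕ.∸ p) * binom n p * binom (p ℕ.+ n) p * g p) ∎
  where
  L = λ k → binom n k * binom (k ℕ.+ n) k
  regroup : ∀ a c s b x → a * c * (s * b * x) ≡ x * (s * a * b * c)
  regroup = solve-∀
  coefficient : ∀ p → p ℕ.≤ n →
    sumTo n (λ k → L k * (sign (k ℕ.∸ p) * binom k p * g p))
      ≡ sign (n ℕ.∸ p) * binom n p * binom (p ℕ.+ n) p * g p
  coefficient p p≤n = begin
    sumTo n (λ k → L k * (sign (k ℕ.∸ p) * binom k p * g p))
      ≡⟨ sumTo-cong n (λ k _ → regroup (binom n k) (binom (k ℕ.+ n) k) (sign (k ℕ.∸ p)) (binom k p) (g p)) ⟩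
    sumTo n (λ k → g p * (sign (k ℕ.∸ p) * binom n k * binom k p * binom (k ℕ.+ n) k))
      ≡⟨ *-distribˡ-sumTo n (g p) _ ⟨
    g p * sumTo n (λ k → sign (k ℕ.∸ p) * binom n k * binom k p * binom (k ℕ.+ n) k)
      ≡⟨ cong (g p *_) (legendre-kernel p≤n) ⟩
    g p * (sign (n ℕ.∸ p) * binom n p * binom (p ℕ.+ n) p)
      ≡⟨ ℤ.*-comm (g p) _ ⟩
    sign (n ℕ.∸ p) * binom n p * binom (p ℕ.+ n) p * g p ∎

legendre-truncate : ∀ m n (G : ℕ → ℤ) → (∀ k → m ℕ.< k → G k ≡ 0ℤ) →
  sumTo m (λ k → binom n k * binom (k ℕ.+ n) k * G k) ≡ sumTo n (λ k → binom n k * binom (k ℕ.+ n) k * G k)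
legendre-truncate m n G G>m≡0 = sumTo-truncate m n _ above-m above-n
  where
  zero-left : ∀ b x → 0ℤ * b * x ≡ 0ℤ
  zero-left = solve-∀
  above-m : ∀ k → m ℕ.< k → binom n k * binom (k ℕ.+ n) k * G k ≡ 0ℤ
  above-m k m<k = trans (cong (binom n k * binom (k ℕ.+ n) k *_) (G>m≡0 k m<k))
                        (ℤ.*-zeroʳ (binom n k * binom (k ℕ.+ n) k))
  above-n : ∀ k → n ℕ.< k → binom n k * binom (k ℕ.+ n) k * G k ≡ 0ℤ
  above-n k n<k = trans (cong (λ b → b * binom (k ℕ.+ n) k * G k) (k>n⇒binom≡0 n<k))
                        (zero-left (binom (k ℕ.+ n) k) (G k))

legendre-reverse : ∀ n (f : ℕ → ℤ) →
  sumTo n (λ p → sign (n ℕ.∸ p) * binom n p * binom (p ℕ.+ n) p * f (n ℕ.∸ p))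
    ≡ sumTo n (λ k → sign k * f k * binom n k * binom (2 ℕ.* n ℕ.∸ k) (n ℕ.∸ k))
legendre-reverse n f = trans (sumTo-reverse n _) (sumTo-cong n term)
  where
  move-f : ∀ s a b x → s * a * b * x ≡ s * x * a * b
  move-f = solve-∀
  term : ∀ k → k ℕ.≤ n →
    sign (n ℕ.∸ (n ℕ.∸ k)) * binom n (n ℕ.∸ k) * binom (n ℕ.∸ k ℕ.+ n) (n ℕ.∸ k) * f (n ℕ.∸ (n ℕ.∸ k))
      ≡ sign k * f k * binom n k * binom (2 ℕ.* n ℕ.∸ k) (n ℕ.∸ k)
  term k k≤n = begin
    sign (n ℕ.∸ (n ℕ.∸ k)) * binom n (n ℕ.∸ k) * binom (n ℕ.∸ k ℕ.+ n) (n ℕ.∸ k) * f (n ℕ.∸ (n ℕ.∸ k))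
      ≡⟨ cong (λ e → sign e * binom n (n ℕ.∸ k) * binom (n ℕ.∸ k ℕ.+ n) (n ℕ.∸ k) * f e)
              (ℕ.m∸[m∸n]≡n k≤n) ⟩
    sign k * binom n (n ℕ.∸ k) * binom (n ℕ.∸ k ℕ.+ n) (n ℕ.∸ k) * f k
      ≡⟨ cong₂ (λ b N → sign k * b * binom N (n ℕ.∸ k) * f k)
               (cong +_ (sym (nCk≡nC[n∸k] k≤n))) n∸k+n≡2n∸k ⟩
    sign k * binom n k * binom (2 ℕ.* n ℕ.∸ k) (n ℕ.∸ k) * f k
      ≡⟨ move-f (sign k) (binom n k) (binom (2 ℕ.* n ℕ.∸ k) (n ℕ.∸ k)) (f k) ⟩
    sign k * f k * binom n k * binom (2 ℕ.* n ℕ.∸ k) (n ℕ.∸ k) ∎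
    where
    n∸k+n≡2n∸k : n ℕ.∸ k ℕ.+ n ≡ 2 ℕ.* n ℕ.∸ k
    n∸k+n≡2n∸k = trans (sym (ℕ.+-∸-comm n k≤n)) (cong (λ x → n ℕ.+ x ℕ.∸ k) (sym (ℕ.+-identityʳ n)))

power-sum-stirling-expansion : ∀ m n →
  sumTo n (λ k → sign (n ℕ.∸ k) * + (k ℕ.^ m) * binom n k * binom (k ℕ.+ n) k)
    ≡ sumTo m (λ k → + (k !) * binom n k * binom (k ℕ.+ n) k * stirling2 m k)
power-sum-stirling-expansion m n = sym (begin
  sumTo m (λ k → + (k !) * binom n k * binom (k ℕ.+ n) k * stirling2 m k)
    ≡⟨ sumTo-cong m (λ k _ → term k) ⟩
  sumTo m (λ k → binom n k * binom (k ℕ.+ n) k * Δ k (shiftedPow 0 m))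
    ≡⟨ legendre-truncate m n (λ k → Δ k (shiftedPow 0 m)) (λ k → Δ-shiftedPow-vanish 0) ⟩
  sumTo n (λ k → binom n k * binom (k ℕ.+ n) k * Δ k (shiftedPow 0 m))
    ≡⟨ legendre-Δ n (shiftedPow 0 m) ⟩
  sumTo n (λ p → sign (n ℕ.∸ p) * binom n p * binom (p ℕ.+ n) p * + (p ℕ.^ m))
    ≡⟨ sumTo-cong n (λ p _ → move-power (sign (n ℕ.∸ p)) (binom n p) (binom (p ℕ.+ n) p) (+ (p ℕ.^ m))) ⟩
  sumTo n (λ k → sign (n ℕ.∸ k) * + (k ℕ.^ m) * binom n k * binom (k ℕ.+ n) k) ∎)
  where
  regroup : ∀ f a b x → f * a * b * x ≡ a * b * (f * x)
  regroup = solve-∀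
  move-power : ∀ s a b x → s * a * b * x ≡ s * x * a * b
  move-power = solve-∀
  term : ∀ k → + (k !) * binom n k * binom (k ℕ.+ n) k * stirling2 m k
             ≡ binom n k * binom (k ℕ.+ n) k * Δ k (shiftedPow 0 m)
  term k = begin
    + (k !) * binom n k * binom (k ℕ.+ n) k * stirling2 m k
      ≡⟨ cong (+ (k !) * binom n k * binom (k ℕ.+ n) k *_) (stirling2≡rStirling m k) ⟩
    + (k !) * binom n k * binom (k ℕ.+ n) k * + rStirling 0 m k
      ≡⟨ regroup (+ (k !)) (binom n k) (binom (k ℕ.+ n) k) (+ rStirling 0 m k) ⟩
    binom n k * binom (k ℕ.+ n) k * (+ (k !) * + rStirling 0 m k)
      ≡⟨ cong (binom n k * binom (k ℕ.+ n) k *_) (j!*rStirling≡Δ 0 m k) ⟩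
    binom n k * binom (k ℕ.+ n) k * Δ k (shiftedPow 0 m) ∎

power-sum-vStirling-expansion : ∀ m n →
  sumTo n (λ k → sign k * + (k ℕ.^ m) * binom n k * binom (2 ℕ.* n ℕ.∸ k) (n ℕ.∸ k))
    ≡ sumTo m (λ k → sign k * + (k !) * binom n k * binom (k ℕ.+ n) k * vStirling m n k)
power-sum-vStirling-expansion m n = sym (begin
  sumTo m (λ k → sign k * + (k !) * binom n k * binom (k ℕ.+ n) k * vStirling m n k)
    ≡⟨ sumTo-cong m (λ k _ → term k) ⟩
  sumTo m (λ k → binom n k * binom (k ℕ.+ n) k * (sign k * Δ k (shiftedPow (n ℕ.∸ k) m)))
    ≡⟨ legendre-truncate m n (λ k → sign k * Δ k (shiftedPow (n ℕ.∸ k) m)) vanish ⟩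
  sumTo n (λ k → binom n k * binom (k ℕ.+ n) k * (sign k * Δ k (shiftedPow (n ℕ.∸ k) m)))
    ≡⟨ sumTo-cong n (λ k k≤n → cong (binom n k * binom (k ℕ.+ n) k *_) (Δ-shiftedPow-reflect m k≤n)) ⟩
  sumTo n (λ k → binom n k * binom (k ℕ.+ n) k * Δ k (λ r → + ((n ℕ.∸ r) ℕ.^ m)))
    ≡⟨ legendre-Δ n (λ r → + ((n ℕ.∸ r) ℕ.^ m)) ⟩
  sumTo n (λ p → sign (n ℕ.∸ p) * binom n p * binom (p ℕ.+ n) p * + ((n ℕ.∸ p) ℕ.^ m))
    ≡⟨ legendre-reverse n (λ k → + (k ℕ.^ m)) ⟩
  sumTo n (λ k → sign k * + (k ℕ.^ m) * binom n k * binom (2 ℕ.* n ℕ.∸ k) (n ℕ.∸ k)) ∎)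
  where
  regroup : ∀ s f a b x → s * f * a * b * x ≡ a * b * (s * (f * x))
  regroup = solve-∀
  term : ∀ k → sign k * + (k !) * binom n k * binom (k ℕ.+ n) k * vStirling m n k
             ≡ binom n k * binom (k ℕ.+ n) k * (sign k * Δ k (shiftedPow (n ℕ.∸ k) m))
  term k = begin
    sign k * + (k !) * binom n k * binom (k ℕ.+ n) k * vStirling m n k
      ≡⟨ cong (sign k * + (k !) * binom n k * binom (k ℕ.+ n) k *_) (vStirling≡rStirling m n k) ⟩
    sign k * + (k !) * binom n k * binom (k ℕ.+ n) k * + rStirling (n ℕ.∸ k) m k
      ≡⟨ regroup (sign k) (+ (k !)) (binom n k) (binom (k ℕ.+ n) k) (+ rStirling (n ℕ.∸ k) m k) ⟩
    binom n k * binom (k ℕ.+ n) k * (sign k * (+ (k !) * + rStirling (n ℕ.∸ k) m k))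
      ≡⟨ cong (λ x → binom n k * binom (k ℕ.+ n) k * (sign k * x)) (j!*rStirling≡Δ (n ℕ.∸ k) m k) ⟩
    binom n k * binom (k ℕ.+ n) k * (sign k * Δ k (shiftedPow (n ℕ.∸ k) m)) ∎
  vanish : ∀ k → m ℕ.< k → sign k * Δ k (shiftedPow (n ℕ.∸ k) m) ≡ 0ℤ
  vanish k m<k = trans (cong (sign k *_) (Δ-shiftedPow-vanish (n ℕ.∸ k) m<k)) (ℤ.*-zeroʳ (sign k))

proposition13 : (m n : ℕ) →
    (sumTo n (λ k → sign (n ℕ.∸ k) ℤ.* + (k ℕ.^ m) ℤ.* binom n k ℤ.* binom (k ℕ.+ n) k)
      ≡ sumTo m (λ k → + (k !) ℤ.* binom n k ℤ.* binom (k ℕ.+ n) k ℤ.* stirling2 m k))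
    ×
    (sumTo n (λ k → sign k ℤ.* + (k ℕ.^ m) ℤ.* binom n k ℤ.* binom (2 ℕ.* n ℕ.∸ k) (n ℕ.∸ k))
      ≡ sumTo m (λ k → sign k ℤ.* + (k !) ℤ.* binom n k ℤ.* binom (k ℕ.+ n) k ℤ.* vStirling m n k))
proposition13 m n = power-sum-stirling-expansion m n , power-sum-vStirling-expansion m n
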